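{- Let $r \in \mathbb{N}$, $A, B \in \mathbb{Z}$, and let $\ell > 0$ be an integer. Let $([a_i, b_i])_{i \in [t]}$ be an $(A,B,r)$-system which is interlaced with buffer $\ell$. Then there exists a subsequence of $([a_i, b_i])_{i \in [t]}$ (preserving the order) that contains $[a_1, b_1]$ and $[a_t, b_t]$ and which is a clean $(A,B,r)$-system interlaced with buffer $\ell$.
   Context: Let $r \in \mathbb{N}$ and $A,B \in \mathbb{Z}$. An $(A,B,r)$-system is a sequence $([a_i,b_i])_{i\in[t]}$ of closed intervals such that for all $i \in [t]$: $a_i, b_i \in \mathbb{Z}$; $[a_i,b_i] \subseteq [A,B]$; if $a_i \ne A$ then $a_i \ge A + r$; and if $b_i \ne B$ then $b_i \le B - r$. Such a system is interlaced with buffer $\ell$ (an integer $\ell > 0$) if $a_1 = A$, $b_t = B$, and for all $i \in [t-1]$: $a_i + \ell \le a_{i+1} \le b_i$ and $b_i + \ell \le b_{i+1}$. The system is clean if $[a_i,b_i] \cap [a_j,b_j] \ne \emptyset$ implies $|i - j| \le 1$. -}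

module Defs where

open import Data.Nat using (ℕ; suc)
import Data.Nat as ℕ
open import Data.Integer using (ℤ; +_; _+_; _-_; _≤_)
open import Data.Fin using (Fin; zero; suc; toℕ; inject₁; fromℕ; _<_)
open import Data.Product using (_×_; ∃)
open import Relation.Binary.PropositionalEquality using (_≡_; _≢_)

-- A finite sequence of closed intervals ([a i , b i])_{i ∈ [t]} with t = suc n
-- (index i : Fin (suc n) stands for the paper's index i+1).

IsSystem : (A B : ℤ) (r : ℕ) (n : ℕ) (a b : Fin (suc n) → ℤ) → Set
IsSystem A B r n a b =
  ∀ i → (a i ≤ b i) × (A ≤ a i) × (b i ≤ B)
        × (a i ≢ A → A + + r ≤ a i)
        × (b i ≢ B → b i ≤ B - + r)

Interlaced : (A B : ℤ) (ℓ : ℤ) (n : ℕ) (a b : Fin (suc n) → ℤ) → Set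
Interlaced A B ℓ n a b =
  (a zero ≡ A) × (b (fromℕ n) ≡ B)
  × (∀ (i : Fin n) → (a (inject₁ i) + ℓ ≤ a (suc i))
                   × (a (suc i) ≤ b (inject₁ i))
                   × (b (inject₁ i) + ℓ ≤ b (suc i)))

Intersect : {n : ℕ} (a b : Fin n → ℤ) (i j : Fin n) → Set
Intersect a b i j = ∃ λ x → (a i ≤ x) × (x ≤ b i) × (a j ≤ x) × (x ≤ b j)

Clean : (n : ℕ) (a b : Fin n → ℤ) → Set
Clean n a b = ∀ i j → Intersect a b i j →
  (toℕ i ℕ.≤ suc (toℕ j)) × (toℕ j ℕ.≤ suc (toℕ i))

IsEndpointSubseq : (s n : ℕ) (σ : Fin (suc s) → Fin (suc n)) → Set
IsEndpointSubseq s n σ =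
  (∀ i j → i < j → σ i < σ j) × (σ zero ≡ zero) × (σ (fromℕ s) ≡ fromℕ n)

-- Greedy choice: from the current interval, jump to the last interval that starts before it
-- ends.  Consecutive chosen intervals then overlap, and since a and b increase by ℓ along
-- increasing indices the subsequence is again interlaced.  Two chosen intervals that are not
-- neighbours are disjoint: the later one lies beyond the furthest jump from the earlier one,
-- so it starts after the earlier one ends.
module Submission where

open import Defs
open import Data.Nat using (ℕ; suc)
open import Data.Integer using (ℤ; +_; _<_)
open import Data.Fin using (Fin)
open import Data.Product using (Σ; _×_)
open import Function using (_∘_)

open import Data.Nat as ℕ using (zero; z≤n; s≤s)
open import Data.Nat.Properties as ℕ
  using (≤-refl; ≤-trans; ≤-reflexive; <⇒≤; <⇒≱; ≤-pred; m≤n⇒m<n∨m≡n; m≤n⇒m≤1+n;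
         +-suc; +-monoʳ-≤; +-identityʳ)
open import Data.Integer as ℤ using (_+_; _≤?_)
import Data.Integer.Properties as ℤ
open import Data.Fin as Fin using (toℕ; inject₁; fromℕ)
open import Data.Fin.Properties
  using (toℕ<n; toℕ≤pred[n]; toℕ-inject₁; toℕ-fromℕ; ≤̄⇒inject₁<)
open import Data.Product using (_,_; proj₁; proj₂)
open import Data.Sum using (inj₁; inj₂)
open import Relation.Binary.Core using (Rel)
open import Relation.Binary.Definitions using (Transitive; Decidable)
open import Relation.Binary.PropositionalEquality
  using (_≡_; refl; sym; trans; cong; subst; subst₂; module ≡-Reasoning)
open import Relation.Nullary using (¬_; yes; no; contradiction)

chain-trans : ∀ {a r} {A : Set a} {_∼_ : Rel A r} → Transitive _∼_ →
  ∀ {n} (f : Fin (suc n) → A) → (∀ (i : Fin n) → f (inject₁ i) ∼ f (Fin.suc i)) →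
  ∀ {i j} → i Fin.< j → f i ∼ f j
chain-trans _ {zero}  f step {Fin.zero} {Fin.zero} ()
chain-trans _ {suc n} f step {Fin.zero} {Fin.suc Fin.zero} _ = step Fin.zero
chain-trans {_∼_ = _∼_} trans∼ {suc n} f step {Fin.zero} {Fin.suc (Fin.suc j)} _ =
  trans∼ (step Fin.zero) (chain-trans {_∼_ = _∼_} trans∼ (f ∘ Fin.suc) (λ i → step (Fin.suc i)) {Fin.zero} {Fin.suc j} (s≤s z≤n))
chain-trans {_∼_ = _∼_} trans∼ {suc n} f step {Fin.suc i} {Fin.suc j} (s≤s i<j) =
  chain-trans {_∼_ = _∼_} trans∼ (f ∘ Fin.suc) (λ i → step (Fin.suc i)) i<j

+ℓ≤-trans : ∀ {ℓ} → + 0 ℤ.≤ ℓ → Transitive (λ x y → x + ℓ ℤ.≤ y)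
+ℓ≤-trans 0≤ℓ {j = y} x+ℓ≤y y+ℓ≤z =
  ℤ.≤-trans x+ℓ≤y (ℤ.≤-trans (ℤ.i≤i+j y _ {{ℤ.nonNegative 0≤ℓ}}) y+ℓ≤z)

interlaced-subseq : ∀ {A B ℓ n s σ} (a b : Fin (suc n) → ℤ) → + 0 ℤ.≤ ℓ →
  Interlaced A B ℓ n a b → IsEndpointSubseq s n σ →
  (∀ (i : Fin s) → a (σ (Fin.suc i)) ℤ.≤ b (σ (inject₁ i))) →
  Interlaced A B ℓ s (a ∘ σ) (b ∘ σ)
interlaced-subseq {ℓ = ℓ} {n} {σ = σ} a b 0≤ℓ (a₀≡A , bₙ≡B , steps) (σ-mono , σ₀ , σₙ) touches =
  trans (cong a σ₀) a₀≡A , trans (cong b σₙ) bₙ≡B ,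
  λ i → grows a (proj₁ ∘ steps) (next i) , touches i , grows b (proj₂ ∘ proj₂ ∘ steps) (next i)
  where
  grows : (f : Fin (suc n) → ℤ) → (∀ i → f (inject₁ i) + ℓ ℤ.≤ f (Fin.suc i)) →
          ∀ {i j} → i Fin.< j → f i + ℓ ℤ.≤ f j
  grows = chain-trans {_∼_ = λ x y → x + ℓ ℤ.≤ y} (λ {x} {y} {z} → +ℓ≤-trans 0≤ℓ {x} {y} {z})
  next : ∀ i → σ (inject₁ i) Fin.< σ (Fin.suc i)
  next i = σ-mono _ _ (≤̄⇒inject₁< ≤-refl)

clean-if-nonconsecutive-disjoint : ∀ {m} (a b : Fin m → ℤ) →
  (∀ i j → suc (toℕ i) ℕ.< toℕ j → ¬ a j ℤ.≤ b i) → Clean m a b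
clean-if-nonconsecutive-disjoint a b disjoint i j (x , aᵢ≤x , x≤bᵢ , aⱼ≤x , x≤bⱼ) =
  close i j (ℤ.≤-trans aᵢ≤x x≤bⱼ) , close j i (ℤ.≤-trans aⱼ≤x x≤bᵢ)
  where
  close : ∀ i j → a i ℤ.≤ b j → toℕ i ℕ.≤ suc (toℕ j)
  close i j aᵢ≤bⱼ with suc (toℕ j) ℕ.<? toℕ i
  ... | yes far = contradiction aᵢ≤bⱼ (disjoint j i far)
  ... | no ¬far = ℕ.≮⇒≥ ¬far

clamp : (n : ℕ) → ℕ → Fin (suc n)
clamp n       zero    = Fin.zero
clamp zero    (suc k) = Fin.zero
clamp (suc n) (suc k) = Fin.suc (clamp n k)

toℕ-clamp : ∀ {n k} → k ℕ.≤ n → toℕ (clamp n k) ≡ k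
toℕ-clamp {n}     {zero}  _         = refl
toℕ-clamp {suc n} {suc k} (s≤s k≤n) = cong suc (toℕ-clamp k≤n)

clamp-self : ∀ n → clamp n n ≡ fromℕ n
clamp-self zero    = refl
clamp-self (suc n) = cong Fin.suc (clamp-self n)

clamp-consecutive : ∀ {n} (P : Fin (suc n) → Fin (suc n) → Set) →
  (∀ (i : Fin n) → P (inject₁ i) (Fin.suc i)) →
  ∀ k → k ℕ.< n → P (clamp n k) (clamp n (suc k))
clamp-consecutive P step zero    (s≤s _)   = step Fin.zero
clamp-consecutive P step (suc k) (s≤s k<n) =
  clamp-consecutive (λ x y → P (Fin.suc x) (Fin.suc y)) (λ i → step (Fin.suc i)) k k<n

module GreedyPath {R : ℕ → ℕ → Set} (R? : Decidable R) (n : ℕ)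
                  (R-suc : ∀ k → k ℕ.< n → R k (suc k)) where

  record Furthest (i m : ℕ) : Set where
    field
      target   : ℕ
      i<target : i ℕ.< target
      target≤m : target ℕ.≤ m
      edge     : R i target
      maximal  : ∀ k → target ℕ.< k → k ℕ.≤ m → ¬ R i k

  furthest : ∀ {i m} → i ℕ.< m → m ℕ.≤ n → Furthest i m
  furthest {i} {suc m} i<1+m 1+m≤n with R? i (suc m)
  ... | yes edge = record
    { target = suc m ; i<target = i<1+m ; target≤m = ≤-refl ; edge = edge
    ; maximal = λ k 1+m<k k≤1+m → contradiction k≤1+m (<⇒≱ 1+m<k) }
  ... | no ¬edge with m≤n⇒m<n∨m≡n (≤-pred i<1+m)
  ...   | inj₂ refl = contradiction (R-suc i 1+m≤n) ¬edge
  ...   | inj₁ i<m = record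
    { target = target ; i<target = i<target ; target≤m = m≤n⇒m≤1+n target≤m ; edge = edge
    ; maximal = maximal′ }
    where
    open Furthest (furthest i<m (<⇒≤ 1+m≤n))
    maximal′ : ∀ k → target ℕ.< k → k ℕ.≤ suc m → ¬ R i k
    maximal′ k target<k k≤1+m with m≤n⇒m<n∨m≡n k≤1+m
    ... | inj₁ k<1+m = maximal k target<k (≤-pred k<1+m)
    ... | inj₂ refl  = ¬edge

  record Path (i s : ℕ) (σ : ℕ → ℕ) : Set where
    field
      start       : σ 0 ≡ i
      end         : σ s ≡ n
      ascending   : ∀ {p q} → p ℕ.< q → q ℕ.≤ s → σ p ℕ.< σ q
      edges       : ∀ k → k ℕ.< s → R (σ k) (σ (suc k))
      no-shortcut : ∀ k m → suc k ℕ.< m → m ℕ.≤ s → ¬ R (σ k) (σ m)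

    bounded : ∀ {k} → k ℕ.≤ s → σ k ℕ.≤ n
    bounded k≤s with m≤n⇒m<n∨m≡n k≤s
    ... | inj₁ k<s = <⇒≤ (subst (_ ℕ.<_) end (ascending k<s ≤-refl))
    ... | inj₂ refl = ≤-reflexive end

  prepend : ℕ → (ℕ → ℕ) → ℕ → ℕ
  prepend i τ zero    = i
  prepend i τ (suc k) = τ k

  extend : ∀ {i s τ} (J : Furthest i n) → Path (Furthest.target J) s τ → Path i (suc s) (prepend i τ)
  extend {i} {s} {τ} J tail = record
    { start = refl ; end = end
    ; ascending = ascending′ ; edges = edges′ ; no-shortcut = no-shortcut′ }
    where
    open Furthest J
    open Path tail
    i<τ₀ : i ℕ.< τ 0
    i<τ₀ = subst (i ℕ.<_) (sym start) i<target
    ascending′ : ∀ {p q} → p ℕ.< q → q ℕ.≤ suc s → prepend i τ p ℕ.< prepend i τ q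
    ascending′ {zero}  {suc zero}    _         _           = i<τ₀
    ascending′ {zero}  {suc (suc q)} _         (s≤s q+1≤s) = ℕ.<-trans i<τ₀ (ascending (s≤s z≤n) q+1≤s)
    ascending′ {suc p} {suc q}       (s≤s p<q) (s≤s q≤s)   = ascending p<q q≤s
    edges′ : ∀ k → k ℕ.< suc s → R (prepend i τ k) (prepend i τ (suc k))
    edges′ zero    _         = subst (R i) (sym start) edge
    edges′ (suc k) (s≤s k<s) = edges k k<s
    no-shortcut′ : ∀ k m → suc k ℕ.< m → m ℕ.≤ suc s → ¬ R (prepend i τ k) (prepend i τ m)
    no-shortcut′ zero    (suc m) (s≤s 0<m)   (s≤s m≤s) =
      maximal (τ m) (subst (ℕ._< τ m) start (ascending 0<m m≤s)) (bounded m≤s)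
    no-shortcut′ (suc k) (suc m) (s≤s k+1<m) (s≤s m≤s) = no-shortcut k m k+1<m m≤s

  path-from : ∀ fuel {i} → i ℕ.≤ n → n ℕ.≤ fuel ℕ.+ i → Σ ℕ λ s → Σ (ℕ → ℕ) (Path i s)
  path-from fuel {i} i≤n n≤fuel+i with m≤n⇒m<n∨m≡n i≤n
  ... | inj₂ refl = 0 , (λ _ → i) , record
    { start = refl ; end = refl
    ; ascending = λ { () z≤n } ; edges = λ _ () ; no-shortcut = λ { _ _ () z≤n } }
  path-from zero       {i} i≤n n≤i         | inj₁ i<n = contradiction n≤i (<⇒≱ i<n)
  path-from (suc fuel) {i} i≤n n≤1+fuel+i | inj₁ i<n =
    let s , τ , tail = path-from fuel target≤m n≤fuel+target in suc s , prepend i τ , extend J tail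
    where
    J : Furthest i n
    J = furthest i<n ≤-refl
    open Furthest J
    n≤fuel+target : n ℕ.≤ fuel ℕ.+ target
    n≤fuel+target = ≤-trans n≤1+fuel+i (≤-trans (≤-reflexive (sym (+-suc fuel i))) (+-monoʳ-≤ fuel i<target))

  greedy-path : Σ ℕ λ s → Σ (ℕ → ℕ) (Path 0 s)
  greedy-path = path-from n z≤n (≤-reflexive (sym (+-identityʳ n)))

shortcut-free-subsequence : ∀ {n} {R : Fin (suc n) → Fin (suc n) → Set} → Decidable R →
  (∀ (i : Fin n) → R (inject₁ i) (Fin.suc i)) →
  Σ ℕ λ s → Σ (Fin (suc s) → Fin (suc n)) λ σ →
    IsEndpointSubseq s n σ
    × (∀ (i : Fin s) → R (σ (inject₁ i)) (σ (Fin.suc i)))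
    × (∀ i j → suc (toℕ i) ℕ.< toℕ j → ¬ R (σ i) (σ j))
shortcut-free-subsequence {n} {R} R? R-step =
  s , σ̂ , (σ̂-ascending , cong (clamp n) start , σ̂-end) , σ̂-edges ,
  λ i j far → no-shortcut (toℕ i) (toℕ j) far (toℕ≤pred[n] j)
  where
  Rℕ : ℕ → ℕ → Set
  Rℕ k m = R (clamp n k) (clamp n m)
  open GreedyPath {Rℕ} (λ k m → R? (clamp n k) (clamp n m)) n (clamp-consecutive R R-step)
  s : ℕ
  s = proj₁ greedy-path
  σ : ℕ → ℕ
  σ = proj₁ (proj₂ greedy-path)
  open Path (proj₂ (proj₂ greedy-path))
  σ̂ : Fin (suc s) → Fin (suc n)
  σ̂ i = clamp n (σ (toℕ i))
  toℕ-σ̂ : ∀ i → toℕ (σ̂ i) ≡ σ (toℕ i)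
  toℕ-σ̂ i = toℕ-clamp (bounded (toℕ≤pred[n] i))
  σ̂-ascending : ∀ i j → i Fin.< j → σ̂ i Fin.< σ̂ j
  σ̂-ascending i j i<j =
    subst₂ ℕ._<_ (sym (toℕ-σ̂ i)) (sym (toℕ-σ̂ j)) (ascending i<j (toℕ≤pred[n] j))
  σ̂-end : σ̂ (fromℕ s) ≡ fromℕ n
  σ̂-end = begin
    clamp n (σ (toℕ (fromℕ s))) ≡⟨ cong (clamp n ∘ σ) (toℕ-fromℕ s) ⟩
    clamp n (σ s)               ≡⟨ cong (clamp n) end ⟩
    clamp n n                   ≡⟨ clamp-self n ⟩
    fromℕ n                     ∎
    where open ≡-Reasoning
  σ̂-edges : ∀ (i : Fin s) → R (σ̂ (inject₁ i)) (σ̂ (Fin.suc i))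
  σ̂-edges i = subst (λ k → R (clamp n (σ k)) (σ̂ (Fin.suc i))) (sym (toℕ-inject₁ i)) (edges (toℕ i) (toℕ<n i))

lemma2p2 : (r : ℕ) (A B ℓ : ℤ) → + 0 < ℓ →
    (n : ℕ) (a b : Fin (suc n) → ℤ) →
    IsSystem A B r n a b → Interlaced A B ℓ n a b →
    Σ ℕ λ s → Σ (Fin (suc s) → Fin (suc n)) λ σ →
      IsEndpointSubseq s n σ
      × IsSystem A B r s (a ∘ σ) (b ∘ σ)
      × Interlaced A B ℓ s (a ∘ σ) (b ∘ σ)
      × Clean (suc s) (a ∘ σ) (b ∘ σ)
lemma2p2 r A B ℓ 0<ℓ n a b system interlaced@(_ , _ , steps)
  with shortcut-free-subsequence (λ i j → a j ≤? b i) (proj₁ ∘ proj₂ ∘ steps)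
... | s , σ , endpoints , overlaps , no-shortcut =
  s , σ , endpoints , system ∘ σ ,
  interlaced-subseq a b (ℤ.<⇒≤ 0<ℓ) interlaced endpoints overlaps ,
  clean-if-nonconsecutive-disjoint (a ∘ σ) (b ∘ σ) no-shortcut
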